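{- Let $m\geq 3$ and $n\geq 2$ be integers with $m\leq n$, and let $K_m$, $K_n$ be the complete graphs of orders $m$ and $n$. Then $$rvcl(K_m\diamond K_n)=\begin{cases} n+1, & \text{if } n\geq |E(K_m)|-1,\\ n+2, & \text{if } n<|E(K_m)|-1,\end{cases}$$ where $|E(K_m)|=m(m-1)/2$.
   Context: All graphs are finite, simple, connected and undirected; $d(\cdot,\cdot)$ is the graph distance. For $k\in\mathbb{N}$, a rainbow vertex $k$-coloring of $G$ is a function $c: V(G)\to\{1,\dots,k\}$ such that every two vertices $u,v$ are joined by a $u$–$v$ path whose internal vertices have pairwise distinct colors. For such $c$ (using all $k$ colors), let $R_i$ be the set of vertices of color $i$ and $\Pi=(R_1,\dots,R_k)$; the rainbow code of $v$ is $rc_\Pi(v)=(d(v,R_1),\dots,d(v,R_k))$, where $d(v,R_i)=\min_{x\in R_i} d(v,x)$. The coloring is a locating rainbow $k$-coloring if all vertices have pairwise distinct rainbow codes; $rvcl(G)$ is the smallest positive integer $k$ such that $G$ has a locating rainbow $k$-coloring. The edge corona $G\diamond H$ is obtained from one copy of $G$ and $|E(G)|$ copies of $H$, where, enumerating the edges of $G$ as $e_1,\dots,e_{|E(G)|}$, both end vertices of $e_j$ are joined to every vertex of the $j$-th copy of $H$. -}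

module Defs where

open import Level using (0ℓ)
open import Data.Nat using (ℕ; zero; suc; _≤_; _<ᵇ_)
open import Data.Bool using (Bool; true; false; T; _∧_; not)
open import Data.Fin using (Fin; toℕ; _≟_)
open import Data.Sum using (_⊎_; inj₁; inj₂)
open import Data.Product using (Σ; ∃; ∃-syntax; _×_; _,_; proj₁; proj₂)
open import Data.List using (List; []; _∷_; _++_; [_]; map)
open import Data.List.Relation.Unary.Linked using (Linked)
open import Data.List.Relation.Unary.Unique.Propositional using (Unique)
open import Function using (Surjective)
open import Relation.Binary.PropositionalEquality using (_≡_; _≢_)
open import Relation.Nullary.Decidable using (⌊_⌋)

record FinGraph (p : ℕ) : Set where
  field
    adj    : Fin p → Fin p → Bool
    sym    : ∀ i j → adj i j ≡ adj j i
    irrefl : ∀ i → adj i i ≡ false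

K : (p : ℕ) → FinGraph p
K p = record
  { adj    = λ i j → not ⌊ i ≟ j ⌋
  ; sym    = symK
  ; irrefl = irrK }
  where
  open import Relation.Nullary using (yes; no)
  open import Relation.Binary.PropositionalEquality using (refl; sym)
  open import Data.Empty using (⊥-elim)
  symK : ∀ i j → not ⌊ i ≟ j ⌋ ≡ not ⌊ j ≟ i ⌋
  symK i j with i ≟ j | j ≟ i
  ... | yes _ | yes _ = refl
  ... | yes e | no n  = ⊥-elim (n (sym e))
  ... | no n  | yes e = ⊥-elim (n (sym e))
  ... | no _  | no _  = refl
  irrK : ∀ i → not ⌊ i ≟ i ⌋ ≡ false
  irrK i with i ≟ i
  ... | yes _ = refl
  ... | no n  = ⊥-elim (n refl)

-- Edges of a FinGraph: pairs (i , j) with i < j that are adjacent.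
-- (The proof component lives in T of a Bool, so it is unique.)
Edge : ∀ {p} → FinGraph p → Set
Edge {p} G = Σ (Fin p × Fin p) λ e →
  T ((toℕ (proj₁ e) <ᵇ toℕ (proj₂ e)) ∧ FinGraph.adj G (proj₁ e) (proj₂ e))

record Graph : Set₁ where
  field
    V   : Set
    _~_ : V → V → Set

-- Edge corona G ◇ H: one copy of G, one copy of H for every edge e of G,
-- both ends of e joined to every vertex of the copy of H belonging to e.
_◇_ : ∀ {p q} → FinGraph p → FinGraph q → Graph
_◇_ {p} {q} G H = record { V = Vtx ; _~_ = A }
  where
  Vtx : Set
  Vtx = Fin p ⊎ (Edge G × Fin q)
  endpoint : Fin p → Edge G → Set
  endpoint a ((x , y) , _) = (a ≡ x) ⊎ (a ≡ y)
  A : Vtx → Vtx → Set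
  A (inj₁ a) (inj₁ b) = T (FinGraph.adj G a b)
  A (inj₁ a) (inj₂ (e , h)) = endpoint a e
  A (inj₂ (e , h)) (inj₁ a) = endpoint a e
  A (inj₂ (e , h)) (inj₂ (e′ , h′)) =
    (proj₁ e ≡ proj₁ e′) × T (FinGraph.adj H h h′)

module _ (G : Graph) where
  open Graph G

  data Walk : V → V → ℕ → Set where
    here : ∀ {u} → Walk u u zero
    step : ∀ {u w v k} → u ~ w → Walk w v k → Walk u v (suc k)

  Dist : V → V → ℕ → Set
  Dist u v k = Walk u v k × (∀ k′ → Walk u v k′ → k ≤ k′)

  IsPath : V → List V → V → Set
  IsPath u ws v = Linked _~_ (u ∷ ws ++ [ v ]) × Unique (u ∷ ws ++ [ v ])

  IsRainbowColoring : (k : ℕ) → (V → Fin k) → Set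
  IsRainbowColoring k c =
    Surjective _≡_ _≡_ c ×
    (∀ u v → u ≢ v → ∃[ ws ] (IsPath u ws v × Unique (map c ws)))

  DistToClass : ∀ {k} → (V → Fin k) → V → Fin k → ℕ → Set
  DistToClass c v i d =
    (∃[ x ] (c x ≡ i × Dist v x d)) ×
    (∀ x d′ → c x ≡ i → Dist v x d′ → d ≤ d′)

  IsLocating : ∀ {k} → (V → Fin k) → Set
  IsLocating {k} c = ∀ u v → u ≢ v →
    ∃[ i ] (∀ a b → DistToClass c u i a → DistToClass c v i b → a ≢ b)

  IsLocatingRainbowColoring : (k : ℕ) → (V → Fin k) → Set
  IsLocatingRainbowColoring k c = IsRainbowColoring k c × IsLocating c

  HasLocatingRainbowColoring : ℕ → Set
  HasLocatingRainbowColoring k = ∃[ c ] IsLocatingRainbowColoring k c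

  rvcl≡ : ℕ → Set
  rvcl≡ r = 1 ≤ r × HasLocatingRainbowColoring r ×
            (∀ k → 1 ≤ k → HasLocatingRainbowColoring k → r ≤ k)

{-# OPTIONS --safe #-}

-- The vertices of one copy of K n are twins, so a locating colouring gives them
-- distinct colours.  With at most n colours every copy carries all colours, and two
-- equally coloured vertices of different copies share their code (0 at their colour,
-- 1 elsewhere); hence more than n colours are needed.  With n + 1 colours every copy
-- misses exactly one colour μ e.  Equally coloured vertices of two copies with the
-- same missing colour j can only be told apart at j, where their distances lie in
-- {2, 3} once no endpoint has colour j; a distance 3 would produce a third such copy
-- (through a vertex off the edge).  This forces the endpoints of e to avoid μ e and
-- μ to be injective, so K m has at most n + 1 edges.  Conversely, if it does, let the
-- copy of e miss only its own colour μ e and give the vertex x the colour μ of an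
-- edge avoiding x; otherwise use n + 2 colours, vertex x getting colour x and the copy
-- of each edge missing two colours chosen injectively away from its endpoints.  In
-- both colourings two vertices are told apart by a colour near one of them and
-- absent from the closed neighbourhood of the other, and rainbow paths only need
-- inner vertices from K m.

module Submission where

open import Defs
open import Data.Nat using (ℕ; _≤_; _<_; _+_; _*_; _∸_; _/_)
open import Data.Product using (_×_)

open import Data.Bool using (T)
open import Data.Bool.Properties using (T-irrelevant; T-∧)
open import Data.Empty using (⊥; ⊥-elim)
open import Data.Fin as Fin using (Fin; toℕ; fromℕ<; punchIn; punchOut)
import Data.Fin.Properties as Fin
open import Data.Fin.Patterns using (0F; 1F; 2F)
open import Data.List using ([]; _∷_; [_]; map)
open import Data.List.Relation.Unary.All using ([]; _∷_)
open import Data.List.Relation.Unary.AllPairs using ([]; _∷_)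
open import Data.List.Relation.Unary.Linked using ([-]; _∷_)
open import Data.List.Relation.Unary.Unique.Propositional using (Unique)
open import Data.Nat as ℕ using (zero; suc; z≤n; s≤s)
open import Data.Nat.DivMod using (m*n/n≡m)
open import Data.Nat.Induction using (<-rec)
open import Data.Nat.Properties as ℕ using (≤-trans; ≤-refl; ≤-antisym)
open import Data.Nat.Solver using (module +-*-Solver)
open import Data.Product using (∃; ∃-syntax; _,_; proj₁; proj₂)
import Data.Sum as Sum
open import Data.Sum using (_⊎_; inj₁; inj₂)
open import Data.Sum.Properties using (inj₁-injective)
open import Function using (_∘_; Injective; Surjective)
open import Function.Bundles using (Equivalence)
open import Relation.Binary using (tri<; tri≈; tri>; DecidableEquality)
open import Relation.Binary.PropositionalEquality
  using (_≡_; _≢_; refl; sym; trans; cong; cong₂; subst; subst₂; module ≡-Reasoning)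
open import Relation.Nullary using (¬_; ¬?; Dec; yes; no)
open import Relation.Nullary.Decidable using (_⊎-dec_; decidable-stable; ¬¬-excluded-middle; fromWitnessFalse)

-- Distances and rainbow codes in a graph

-- Distances are only known to exist classically.  They are used inside the
-- double-negation monad, which suffices since every goal is ⊥ or decidable.
Minimal : (ℕ → Set) → ℕ → Set
Minimal P d = P d × (∀ d′ → P d′ → d ≤ d′)

¬¬-minimal : {P : ℕ → Set} → ∀ n → P n → ¬ ¬ ∃ (Minimal P)
¬¬-minimal {P} = <-rec (λ n → P n → ¬ ¬ ∃ (Minimal P)) go
  where
  go : ∀ n → (∀ {d} → d < n → P d → ¬ ¬ ∃ (Minimal P)) → P n → ¬ ¬ ∃ (Minimal P)
  go n smaller pn ¬min = ¬¬-excluded-middle {A = ∃[ d ] (d < n × P d)} λ where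
    (yes (d , d<n , pd)) → smaller d<n pd ¬min
    (no ¬smaller) → ¬min (n , pn , λ d pd → ℕ.≮⇒≥ λ d<n → ¬smaller (d , d<n , pd))

module Distances (G : Graph) where
  open Graph G

  private variable
    u v x : V
    ℓ : ℕ

  walk-0 : Walk G u v 0 → u ≡ v
  walk-0 here = refl

  walk-1 : Walk G u v 1 → u ~ v
  walk-1 (step u~v here) = u~v

  ¬¬-dist : Walk G u v ℓ → ¬ ¬ (∃[ d ] (d ≤ ℓ × Dist G u v d))
  ¬¬-dist {ℓ = ℓ} walk ¬dist =
    ¬¬-minimal ℓ walk λ (d , dist) → ¬dist (d , proj₂ dist ℓ walk , dist)

  Absorbs : V → V → Set
  Absorbs u v = ∀ w → w ≢ u → v ~ w → u ~ w

  ¬¬-walk-transfer : Absorbs u v → Walk G v x (suc ℓ) → ¬ ¬ (∃[ ℓ′ ] (ℓ′ ≤ suc ℓ × Walk G u x ℓ′))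
  ¬¬-walk-transfer {u = u} absorbs (step {w = w} v~w walk) ¬transfer =
    ¬¬-excluded-middle {A = w ≡ u} λ where
      (yes refl) → ¬transfer (_ , ℕ.n≤1+n _ , walk)
      (no w≢u) → ¬transfer (_ , ≤-refl , step (absorbs w w≢u v~w) walk)

  module Colouring {k : ℕ} (c : V → Fin k) where

    private variable
      i : Fin k
      a b : ℕ

    DistTo : V → Fin k → ℕ → Set
    DistTo = DistToClass G c

    distTo-functional : DistTo u i a → DistTo u i b → a ≡ b
    distTo-functional ((x , cx , dx) , minx) ((y , cy , dy) , miny) =
      ≤-antisym (minx y _ cy dy) (miny x _ cx dx)

    distTo-0 : c u ≡ i → DistTo u i 0
    distTo-0 {u} cu = (u , cu , here , λ _ _ → z≤n) , λ _ _ _ _ → z≤n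

    distTo-≤-walk : DistTo u i a → c x ≡ i → Walk G u x ℓ → a ≤ ℓ
    distTo-≤-walk dist cx walk = decidable-stable (_ ℕ.≤? _) λ a≰ℓ →
      ¬¬-dist walk λ (d , d≤ℓ , distx) → a≰ℓ (≤-trans (proj₂ dist _ d cx distx) d≤ℓ)

    distTo-1 : c u ≢ i → u ~ x → c x ≡ i → DistTo u i 1
    distTo-1 {u} {i} {x} cu≢i u~x cx =
      (x , cx , step u~x here , λ _ → positive cx) , λ y _ cy → positive cy ∘ proj₁
      where
      positive : ∀ {y ℓ} → c y ≡ i → Walk G u y ℓ → 1 ≤ ℓ
      positive {ℓ = zero} cy walk with walk-0 walk
      ... | refl = ⊥-elim (cu≢i cy)
      positive {ℓ = suc ℓ} _ _ = s≤s z≤n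

    distTo-0⁻ : DistTo u i 0 → c u ≡ i
    distTo-0⁻ ((x , cx , walk , _) , _) with walk-0 walk
    ... | refl = cx

    ¬¬-distTo : c x ≡ i → Walk G u x ℓ → ¬ ¬ (∃[ a ] (a ≤ ℓ × DistTo u i a))
    ¬¬-distTo {x} {i} {u} cx walk ¬dist = ¬¬-dist walk λ (d , d≤ℓ , distx) →
      ¬¬-minimal {P = λ d → ∃[ y ] (c y ≡ i × Dist G u y d)} d (x , cx , distx) λ (a , at , least) →
        ¬dist (a , ≤-trans (least d (x , cx , distx)) d≤ℓ , at ,
               λ y d′ cy disty → least d′ (y , cy , disty))

    Near : V → Fin k → Set
    Near u i = c u ≡ i ⊎ ∃[ x ] (u ~ x × c x ≡ i)

    Far : V → Fin k → Set
    Far u i = c u ≢ i × (∀ x → u ~ x → c x ≢ i)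

    near⇒coloured : ∀ u → Near u i → ∃[ x ] c x ≡ i
    near⇒coloured u (inj₁ cu) = u , cu
    near⇒coloured _ (inj₂ (x , _ , cx)) = x , cx

    near⇒distTo≤1 : Near u i → DistTo u i a → a ≤ 1
    near⇒distTo≤1 (inj₁ cu) dist = ≤-trans (distTo-≤-walk dist cu here) z≤n
    near⇒distTo≤1 (inj₂ (x , u~x , cx)) dist = distTo-≤-walk dist cx (step u~x here)

    far⇒2≤distTo : Far u i → DistTo u i a → 2 ≤ a
    far⇒2≤distTo {a = zero} (cu≢i , _) dist = ⊥-elim (cu≢i (distTo-0⁻ dist))
    far⇒2≤distTo {a = 1} (_ , ¬adj) ((x , cx , walk , _) , _) = ⊥-elim (¬adj x (walk-1 walk) cx)
    far⇒2≤distTo {a = suc (suc a)} _ _ = s≤s (s≤s z≤n)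

    Distinguishes : Fin k → V → V → Set
    Distinguishes i u v = ∀ a b → DistTo u i a → DistTo v i b → a ≢ b

    colour-distinguishes : c u ≡ i → c v ≢ i → Distinguishes i u v
    colour-distinguishes cu cv≢i a b du dv a≡b = cv≢i (distTo-0⁻ (subst (DistTo _ _) b≡0 dv))
      where
      b≡0 : b ≡ 0
      b≡0 = trans (sym a≡b) (distTo-functional du (distTo-0 cu))

    near-far-distinguishes : Near u i → Far v i → Distinguishes i u v
    near-far-distinguishes near far a b du dv refl =
      ℕ.<⇒≱ (s≤s (near⇒distTo≤1 near du)) (far⇒2≤distTo far dv)

    distinguishes-sym : Distinguishes i u v → Distinguishes i v u
    distinguishes-sym distinguishes a b dv du a≡b = distinguishes b a du dv (sym a≡b)

    SameCode : V → V → Set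
    SameCode u v = ∀ i → ¬ ¬ (∃[ a ] (DistTo u i a × DistTo v i a))

    locating⇒¬sameCode : IsLocating G c → u ≢ v → ¬ SameCode u v
    locating⇒¬sameCode locating u≢v same with locating _ _ u≢v
    ... | i , distinguishes = same i λ (a , du , dv) → distinguishes a a du dv refl

    twins-sameCode : Absorbs u v → Absorbs v u → c u ≡ c v →
                     (∀ i → ¬ ¬ ∃ (DistTo u i)) → SameCode u v
    twins-sameCode {u} {v} u≽v v≽u cu≡cv ¬¬distTo i ¬same with c u Fin.≟ i
    ... | yes cu = ¬same (0 , distTo-0 cu , distTo-0 (trans (sym cu≡cv) cu))
    ... | no cu≢i = ¬¬distTo i λ (a , du) → ¬¬-transfer du λ dv → ¬same (a , du , dv)
      where
      lower : ∀ {a y ℓ} → DistTo u i a → c y ≡ i → Walk G v y ℓ → a ≤ ℓ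
      lower {ℓ = zero} _ cy walk with walk-0 walk
      ... | refl = ⊥-elim (cu≢i (trans cu≡cv cy))
      lower {ℓ = suc ℓ} du cy walk = decidable-stable (_ ℕ.≤? _) λ a≰ →
        ¬¬-walk-transfer u≽v walk λ (ℓ′ , ℓ′≤ , walk′) → a≰ (≤-trans (distTo-≤-walk du cy walk′) ℓ′≤)

      ¬¬-transfer : ∀ {a} → DistTo u i a → ¬ ¬ DistTo v i a
      ¬¬-transfer {zero} du = ⊥-elim (cu≢i (distTo-0⁻ du))
      ¬¬-transfer {suc a} du@((x , cx , walk , _) , _) ¬dv =
        ¬¬-walk-transfer v≽u walk λ (ℓ , ℓ≤ , walk′) →
          ¬dv ((x , cx , subst (Walk G v x) (≤-antisym ℓ≤ (lower du cx walk′)) walk′ , λ _ → lower du cx) ,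
               λ y _ cy → lower du cy ∘ proj₁)

    twins-distinct-colours : IsLocating G c → (∀ w i → ¬ ¬ ∃ (DistTo w i)) →
                             Absorbs u v → Absorbs v u → u ≢ v → c u ≢ c v
    twins-distinct-colours locating ¬¬distTo u≽v v≽u u≢v cu≡cv =
      locating⇒¬sameCode locating u≢v (twins-sameCode u≽v v≽u cu≡cv (¬¬distTo _))

-- Injections between finite sets

injective⇒surjective : ∀ {a b} {f : Fin a → Fin b} → Injective _≡_ _≡_ f → b ≤ a → ∀ t → ∃[ h ] f h ≡ t
injective⇒surjective {b = suc b} {f} f-injective b≤a t with Fin.any? (λ h → f h Fin.≟ t)
... | yes hit = hit
... | no ¬hit = ⊥-elim (ℕ.<⇒≱ b≤a (Fin.injective⇒≤ g-injective))
  where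
  g : Fin _ → Fin b
  g h = punchOut {i = t} {j = f h} (λ t≡fh → ¬hit (h , sym t≡fh))
  g-injective : Injective _≡_ _≡_ g
  g-injective = f-injective ∘ Fin.punchOut-injective {i = t} _ _

module _ {n} {f : Fin n → Fin (suc n)} (f-injective : Injective _≡_ _≡_ f) where

  misses-some : ∃[ t ] (∀ h → f h ≢ t)
  misses-some with Fin.any? (λ t → Fin.all? (λ h → ¬? (f h Fin.≟ t)))
  ... | yes missed = missed
  ... | no ¬missed = ⊥-elim (Fin.<⇒notInjective ℕ.≤-refl preimage-injective)
    where
    preimage : ∀ t → ∃[ h ] f h ≡ t
    preimage t = decidable-stable (Fin.any? λ h → f h Fin.≟ t) λ ¬hit →
      ¬missed (t , λ h fh≡t → ¬hit (h , fh≡t))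
    preimage-injective : Injective _≡_ _≡_ (proj₁ ∘ preimage)
    preimage-injective {t} {t′} eq =
      trans (sym (proj₂ (preimage t))) (trans (cong f eq) (proj₂ (preimage t′)))

  hits-all-but : ∀ {t t′} → (∀ h → f h ≢ t) → t′ ≢ t → ∃[ h ] f h ≡ t′
  hits-all-but {t} {t′} missed t′≢t with injective⇒surjective g-injective ≤-refl (punchOut (t′≢t ∘ sym))
    where
    g : Fin n → Fin n
    g h = punchOut {i = t} {j = f h} (missed h ∘ sym)
    g-injective : Injective _≡_ _≡_ g
    g-injective = f-injective ∘ Fin.punchOut-injective {i = t} _ _
  ... | h , gh≡ = h , Fin.punchOut-injective {i = t} (missed h ∘ sym) (t′≢t ∘ sym) gh≡

punchIn-onto : ∀ {n} {p t : Fin (suc n)} → t ≢ p → ∃[ h ] punchIn p h ≡ t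
punchIn-onto t≢p = punchOut (t≢p ∘ sym) , Fin.punchIn-punchOut _

-- As q = punchIn p (punchOut p≢q), skip₂ p q enumerates the colours other than p and q.
skip₂ : ∀ {n} (p q : Fin (suc (suc n))) → p ≢ q → Fin n → Fin (suc (suc n))
skip₂ p q p≢q = punchIn p ∘ punchIn (punchOut p≢q)

module _ {n} {p q : Fin (suc (suc n))} (p≢q : p ≢ q) where

  skip₂-injective : Injective _≡_ _≡_ (skip₂ p q p≢q)
  skip₂-injective = Fin.punchIn-injective (punchOut p≢q) _ _ ∘ Fin.punchIn-injective p _ _

  skip₂-≢ₗ : ∀ h → skip₂ p q p≢q h ≢ p
  skip₂-≢ₗ _ = Fin.punchInᵢ≢i p _

  skip₂-≢ᵣ : ∀ h → skip₂ p q p≢q h ≢ q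
  skip₂-≢ᵣ h eq = Fin.punchInᵢ≢i (punchOut p≢q) h
    (Fin.punchIn-injective p _ _ (trans eq (sym (Fin.punchIn-punchOut p≢q))))

  skip₂-onto : ∀ {t} → t ≢ p → t ≢ q → ∃[ h ] skip₂ p q p≢q h ≡ t
  skip₂-onto {t} t≢p t≢q with punchIn-onto t≢p
  ... | s , ps≡t with punchIn-onto {p = punchOut p≢q} {t = s} (t≢q ∘ skipped)
    where
    skipped : s ≡ punchOut p≢q → t ≡ q
    skipped s≡ = trans (sym ps≡t) (trans (cong (punchIn p) s≡) (Fin.punchIn-punchOut p≢q))
  ...   | h , eq = h , trans (cong (punchIn p) eq) ps≡t

pair-⊆ : ∀ {A : Set} {x y x′ y′ : A} → x′ ≢ y′ → x′ ≡ x ⊎ x′ ≡ y → y′ ≡ x ⊎ y′ ≡ y →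
         (x′ ≡ x × y′ ≡ y) ⊎ (x′ ≡ y × y′ ≡ x)
pair-⊆ _ (inj₁ p) (inj₂ q) = inj₁ (p , q)
pair-⊆ _ (inj₂ p) (inj₁ q) = inj₂ (p , q)
pair-⊆ x′≢y′ (inj₁ p) (inj₁ q) = ⊥-elim (x′≢y′ (trans p (sym q)))
pair-⊆ x′≢y′ (inj₂ p) (inj₂ q) = ⊥-elim (x′≢y′ (trans p (sym q)))

-- Triangular numbers

tri : ℕ → ℕ
tri zero = 0
tri (suc j) = tri j + j

tri-mono-≤ : ∀ {i j} → i ≤ j → tri i ≤ tri j
tri-mono-≤ {zero} _ = z≤n
tri-mono-≤ {suc i} {suc j} (s≤s i≤j) = ℕ.+-mono-≤ (tri-mono-≤ i≤j) i≤j

pair-index-< : ∀ {a b c} → a < b → b < c → tri b + a < tri c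
pair-index-< {a} {b} a<b b<c = ℕ.<-≤-trans (ℕ.+-monoʳ-< (tri b) a<b) (tri-mono-≤ b<c)

pair-index-injective : ∀ {a b a′ b′} → a < b → a′ < b′ → tri b + a ≡ tri b′ + a′ → a ≡ a′ × b ≡ b′
pair-index-injective {a} {b} {a′} {b′} a<b a′<b′ eq with ℕ.<-cmp b b′
... | tri< b<b′ _ _ =
  ⊥-elim (ℕ.<⇒≱ (pair-index-< a<b b<b′) (subst (tri b′ ≤_) (sym eq) (ℕ.m≤m+n (tri b′) a′)))
... | tri> _ _ b′<b =
  ⊥-elim (ℕ.<⇒≱ (pair-index-< a′<b′ b′<b) (subst (tri b ≤_) eq (ℕ.m≤m+n (tri b) a)))
... | tri≈ _ refl _ = ℕ.+-cancelˡ-≡ (tri b) _ _ eq , refl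

pair-index-surjective : ∀ c k → k < tri c → ∃[ a ] ∃[ b ] (a < b × b < c × tri b + a ≡ k)
pair-index-surjective (suc c) k k<tri with k ℕ.<? tri c
... | yes k<tri′ with pair-index-surjective c k k<tri′
...   | a , b , a<b , b<c , eq = a , b , a<b , ℕ.m≤n⇒m≤1+n b<c , eq
pair-index-surjective (suc c) k k<tri | no k≮tri′ = k ∸ tri c , c , a<c , ℕ.n<1+n c , ℕ.m+[n∸m]≡n tri′≤k
  where
  tri′≤k : tri c ≤ k
  tri′≤k = ℕ.≮⇒≥ k≮tri′
  a<c : k ∸ tri c < c
  a<c = ℕ.+-cancelˡ-< (tri c) _ _ (subst (_< tri c + c) (sym (ℕ.m+[n∸m]≡n tri′≤k)) k<tri)

half-m[m∸1]≡tri : ∀ m → (m * (m ∸ 1)) / 2 ≡ tri m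
half-m[m∸1]≡tri m = trans (cong (_/ 2) (sym (tri*2 m))) (m*n/n≡m (tri m) 2)
  where
  open ≡-Reasoning
  open +-*-Solver using (solve; _:+_; _:*_; _:=_; con)

  tri*2 : ∀ m → tri m * 2 ≡ m * (m ∸ 1)
  tri*2 zero = refl
  tri*2 (suc zero) = refl
  tri*2 (suc (suc m)) = begin
    (tri (suc m) + suc m) * 2     ≡⟨ ℕ.*-distribʳ-+ 2 (tri (suc m)) (suc m) ⟩
    tri (suc m) * 2 + suc m * 2   ≡⟨ cong (_+ suc m * 2) (tri*2 (suc m)) ⟩
    suc m * m + suc m * 2         ≡⟨ solve 1 (λ m → (con 1 :+ m) :* m :+ (con 1 :+ m) :* con 2
                                                  := (con 2 :+ m) :* (con 1 :+ m)) refl m ⟩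
    suc (suc m) * suc m           ∎

-- The edge corona K m ◇ K n

K-adjacent : ∀ {p} {a b : Fin p} → a ≢ b → T (FinGraph.adj (K p) a b)
K-adjacent = fromWitnessFalse

module Corona (m′ n : ℕ) where

  m : ℕ
  m = 3 + m′

  G : Graph
  G = K m ◇ K n

  open Graph G public using (V; _~_)
  open Distances G public

  E : Set
  E = Edge (K m)

  end₁ end₂ : E → Fin m
  end₁ ((a , _) , _) = a
  end₂ ((_ , b) , _) = b

  _∈ₑ_ : Fin m → E → Set
  w ∈ₑ e = w ≡ end₁ e ⊎ w ≡ end₂ e

  edge-≡ : ∀ {e e′ : E} → proj₁ e ≡ proj₁ e′ → e ≡ e′
  edge-≡ {_ , p} {_ , q} refl = cong (_ ,_) (T-irrelevant p q)

  _≟ₑ_ : DecidableEquality E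
  e ≟ₑ e′ with end₁ e Fin.≟ end₁ e′ | end₂ e Fin.≟ end₂ e′
  ... | yes p | yes q = yes (edge-≡ (cong₂ _,_ p q))
  ... | no ¬p | _ = no (¬p ∘ cong end₁)
  ... | yes _ | no ¬q = no (¬q ∘ cong end₂)

  end₁<end₂ : ∀ e → toℕ (end₁ e) < toℕ (end₂ e)
  end₁<end₂ (_ , p) = ℕ.<ᵇ⇒< _ _ (proj₁ (Equivalence.to T-∧ p))

  end₁≢end₂ : ∀ e → end₁ e ≢ end₂ e
  end₁≢end₂ e = ℕ.<⇒≢ (end₁<end₂ e) ∘ cong toℕ

  edge< : (a b : Fin m) → toℕ a < toℕ b → E
  edge< a b a<b = (a , b) , Equivalence.from T-∧ (ℕ.<⇒<ᵇ a<b , K-adjacent (ℕ.<⇒≢ a<b ∘ cong toℕ))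

  edge : (a b : Fin m) → a ≢ b → E
  edge a b a≢b with ℕ.<-cmp (toℕ a) (toℕ b)
  ... | tri< a<b _ _ = edge< a b a<b
  ... | tri≈ _ a≡b _ = ⊥-elim (a≢b (Fin.toℕ-injective a≡b))
  ... | tri> _ _ b<a = edge< b a b<a

  edge-ends : ∀ a b a≢b → a ∈ₑ edge a b a≢b × b ∈ₑ edge a b a≢b
  edge-ends a b a≢b with ℕ.<-cmp (toℕ a) (toℕ b)
  ... | tri< _ _ _ = inj₁ refl , inj₂ refl
  ... | tri≈ _ a≡b _ = ⊥-elim (a≢b (Fin.toℕ-injective a≡b))
  ... | tri> _ _ _ = inj₂ refl , inj₁ refl

  ∈-edge⁻ : ∀ {a b a≢b w} → w ∈ₑ edge a b a≢b → w ≡ a ⊎ w ≡ b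
  ∈-edge⁻ {a} {b} {a≢b} w∈ with ℕ.<-cmp (toℕ a) (toℕ b)
  ... | tri< _ _ _ = w∈
  ... | tri≈ _ a≡b _ = ⊥-elim (a≢b (Fin.toℕ-injective a≡b))
  ... | tri> _ _ _ = Sum.swap w∈

  avoid : (x y : Fin m) → ∃[ z ] (z ≢ x × z ≢ y)
  avoid 0F 0F = 1F , (λ ()) , (λ ())
  avoid 0F 1F = 2F , (λ ()) , (λ ())
  avoid 0F (Fin.suc (Fin.suc _)) = 1F , (λ ()) , (λ ())
  avoid 1F 0F = 2F , (λ ()) , (λ ())
  avoid 1F (Fin.suc _) = 0F , (λ ()) , (λ ())
  avoid (Fin.suc (Fin.suc _)) 0F = 1F , (λ ()) , (λ ())
  avoid (Fin.suc (Fin.suc _)) (Fin.suc _) = 0F , (λ ()) , (λ ())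

  two-edges-at : ∀ x → ∃[ g ] ∃[ g′ ] (x ∈ₑ g × x ∈ₑ g′ × g ≢ g′)
  two-edges-at x with avoid x x
  ... | y , y≢x , _ with avoid x y
  ... | z , z≢x , z≢y =
    edge x y (y≢x ∘ sym) , edge x z (z≢x ∘ sym) , proj₁ (edge-ends x y _) , proj₁ (edge-ends x z _) , g≢g′
    where
    g≢g′ : edge x y (y≢x ∘ sym) ≢ edge x z (z≢x ∘ sym)
    g≢g′ g≡g′ with ∈-edge⁻ (subst (y ∈ₑ_) g≡g′ (proj₂ (edge-ends x y _)))
    ... | inj₁ y≡x = y≢x y≡x
    ... | inj₂ y≡z = z≢y (sym y≡z)

  flanking-edges : ∀ e → ∃[ g₁ ] ∃[ g₂ ] (end₁ e ∈ₑ g₁ × end₂ e ∈ₑ g₂ × g₁ ≢ e × g₂ ≢ e × g₁ ≢ g₂)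
  flanking-edges e with avoid (end₁ e) (end₂ e)
  ... | z , z≢x , z≢y =
    g₁ , g₂ , proj₁ (edge-ends x z _) , proj₁ (edge-ends y z _) , g≢e (proj₂ (edge-ends x z _)) ,
    g≢e (proj₂ (edge-ends y z _)) , g₁≢g₂
    where
    x y : Fin m
    x = end₁ e
    y = end₂ e
    g₁ g₂ : E
    g₁ = edge x z (z≢x ∘ sym)
    g₂ = edge y z (z≢y ∘ sym)
    g≢e : ∀ {g} → z ∈ₑ g → g ≢ e
    g≢e z∈g refl = Sum.[ z≢x , z≢y ] z∈g
    g₁≢g₂ : g₁ ≢ g₂
    g₁≢g₂ g₁≡g₂ with ∈-edge⁻ (subst (x ∈ₑ_) g₁≡g₂ (proj₁ (edge-ends x z _)))
    ... | inj₁ x≡y = end₁≢end₂ e x≡y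
    ... | inj₂ x≡z = z≢x (sym x≡z)

  walk-from-K : ∀ a v → ∃[ ℓ ] (ℓ ≤ 2 × Walk G (inj₁ a) v ℓ)
  walk-from-K a (inj₁ b) with a Fin.≟ b
  ... | yes refl = 0 , z≤n , here
  ... | no a≢b = 1 , s≤s z≤n , step (K-adjacent a≢b) here
  walk-from-K a (inj₂ (e , h)) with a Fin.≟ end₁ e
  ... | yes a≡end = 1 , s≤s z≤n , step (inj₁ a≡end) here
  ... | no a≢end = 2 , ≤-refl , step (K-adjacent a≢end) (step (inj₁ refl) here)

  walk≤3 : ∀ u v → ∃[ ℓ ] (ℓ ≤ 3 × Walk G u v ℓ)
  walk≤3 (inj₁ a) v with walk-from-K a v
  ... | ℓ , ℓ≤2 , walk = ℓ , ℕ.m≤n⇒m≤1+n ℓ≤2 , walk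
  walk≤3 (inj₂ (e , h)) v with walk-from-K (end₁ e) v
  ... | ℓ , ℓ≤2 , walk = suc ℓ , s≤s ℓ≤2 , step (inj₁ refl) walk

  copy-absorbs : ∀ e h h′ → Absorbs (inj₂ (e , h)) (inj₂ (e , h′))
  copy-absorbs e h h′ (inj₁ _) _ end = end
  copy-absorbs e h h′ (inj₂ (e″ , h″)) w≢ (same-copy , _) = same-copy , K-adjacent h≢h″
    where
    h≢h″ : h ≢ h″
    h≢h″ refl with edge-≡ {e} {e″} same-copy
    ... | refl = w≢ refl

  index : E → ℕ
  index e = tri (toℕ (end₂ e)) + toℕ (end₁ e)

  index<tri : ∀ e → index e < tri m
  index<tri e = pair-index-< (end₁<end₂ e) (Fin.toℕ<n (end₂ e))

  index-injective : ∀ {e e′} → index e ≡ index e′ → e ≡ e′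
  index-injective {e} {e′} eq with pair-index-injective (end₁<end₂ e) (end₁<end₂ e′) eq
  ... | a≡a′ , b≡b′ = edge-≡ (cong₂ _,_ (Fin.toℕ-injective a≡a′) (Fin.toℕ-injective b≡b′))

  edgeAt : Fin (tri m) → E
  edgeAt k with pair-index-surjective m (toℕ k) (Fin.toℕ<n k)
  ... | a , b , a<b , b<m , _ =
    edge< (fromℕ< (ℕ.<-trans a<b b<m)) (fromℕ< b<m)
          (subst₂ _<_ (sym (Fin.toℕ-fromℕ< _)) (sym (Fin.toℕ-fromℕ< _)) a<b)

  index-edgeAt : ∀ k → index (edgeAt k) ≡ toℕ k
  index-edgeAt k with pair-index-surjective m (toℕ k) (Fin.toℕ<n k)
  ... | a , b , a<b , b<m , eq =
    trans (cong₂ (λ b a → tri b + a) (Fin.toℕ-fromℕ< b<m) (Fin.toℕ-fromℕ< (ℕ.<-trans a<b b<m))) eq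

  edgeAt-injective : Injective _≡_ _≡_ edgeAt
  edgeAt-injective {k} {k′} eq =
    Fin.toℕ-injective (trans (sym (index-edgeAt k)) (trans (cong index eq) (index-edgeAt k′)))

  _∈ₑ?_ : ∀ w e → Dec (w ∈ₑ e)
  w ∈ₑ? e = (w Fin.≟ end₁ e) ⊎-dec (w Fin.≟ end₂ e)

  module CoronaColouring {k : ℕ} (c : V → Fin k) where
    open Colouring c public

    InCopy : E → Fin k → Set
    InCopy e t = ∃[ h ] c (inj₂ (e , h)) ≡ t

    Avoids : E → Fin k → Set
    Avoids e t = (∀ w → w ∈ₑ e → c (inj₁ w) ≢ t) × (∀ h → c (inj₂ (e , h)) ≢ t)

    K-near-K-colour : ∀ x y → Near (inj₁ x) (c (inj₁ y))
    K-near-K-colour x y with x Fin.≟ y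
    ... | yes refl = inj₁ refl
    ... | no x≢y = inj₂ (inj₁ y , K-adjacent x≢y , refl)

    inCopy⇒K-near : ∀ {x} e {t} → x ∈ₑ e → InCopy e t → Near (inj₁ x) t
    inCopy⇒K-near _ x∈e (h , ch) = inj₂ (inj₂ (_ , h) , x∈e , ch)

    inCopy⇒near : ∀ {e t} h → InCopy e t → Near (inj₂ (e , h)) t
    inCopy⇒near h (h′ , ch′) with h Fin.≟ h′
    ... | yes refl = inj₁ ch′
    ... | no h≢h′ = inj₂ (_ , (refl , K-adjacent h≢h′) , ch′)

    inCopy-distTo-1 : ∀ {e h t} → c (inj₂ (e , h)) ≢ t → InCopy e t → DistTo (inj₂ (e , h)) t 1
    inCopy-distTo-1 {h = h} ch≢t (h′ , ch′) = distTo-1 ch≢t (refl , K-adjacent h≢h′) ch′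
      where
      h≢h′ : h ≢ h′
      h≢h′ refl = ch≢t ch′

    avoids⇒far : ∀ {e t} h → Avoids e t → Far (inj₂ (e , h)) t
    avoids⇒far {e} {t} h (ends , copy) = copy h , λ where
      (inj₁ w) w∈e → ends w w∈e
      (inj₂ (e′ , h′)) (same-copy , _) →
        subst (λ e″ → c (inj₂ (e″ , h′)) ≢ t) (edge-≡ same-copy) (copy h′)

  -- Lower bounds

  module LocatingColouring {k : ℕ} (c : V → Fin k) (onto : Surjective _≡_ _≡_ c)
                           (locating : IsLocating G c) where
    open CoronaColouring c public

    private variable
      e : E
      h : Fin n
      i j : Fin k
      a : ℕ
      w : V

    ¬¬-distTo-exists : ∀ w i → ¬ ¬ ∃ (DistTo w i)
    ¬¬-distTo-exists w i ¬dist with onto i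
    ... | x , cx with walk≤3 w x
    ...   | _ , _ , walk = ¬¬-distTo (cx refl) walk λ (a , _ , dist) → ¬dist (a , dist)

    distTo≤3 : DistTo w i a → a ≤ 3
    distTo≤3 {w} {i} dist with onto i
    ... | x , cx with walk≤3 w x
    ...   | _ , ℓ≤3 , walk = ≤-trans (distTo-≤-walk dist (cx refl) walk) ℓ≤3

    copy-injective : ∀ e → Injective _≡_ _≡_ (λ h → c (inj₂ (e , h)))
    copy-injective e {h} {h′} ch≡ch′ = decidable-stable (h Fin.≟ h′) λ h≢h′ →
      twins-distinct-colours locating ¬¬-distTo-exists (copy-absorbs e h h′) (copy-absorbs e h′ h)
                             (λ { refl → h≢h′ refl }) ch≡ch′

    avoids-distTo-2-or-3 : Avoids e j → DistTo (inj₂ (e , h)) j a → a ≡ 2 ⊎ a ≡ 3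
    avoids-distTo-2-or-3 avoids dist =
      between-2-3 (far⇒2≤distTo (avoids⇒far _ avoids) dist) (distTo≤3 dist)
      where
      between-2-3 : ∀ {a} → 2 ≤ a → a ≤ 3 → a ≡ 2 ⊎ a ≡ 3
      between-2-3 {1} (s≤s ()) _
      between-2-3 {2} _ _ = inj₁ refl
      between-2-3 {3} _ _ = inj₂ refl
      between-2-3 {suc (suc (suc (suc _)))} _ (s≤s (s≤s (s≤s ())))

    ¬all-copies-full : ¬ (∀ e t → InCopy e t)
    ¬all-copies-full full = locating⇒¬sameCode locating (λ ()) same-code
      where
      e₀₁ e₀₂ : E
      e₀₁ = edge< 0F 1F (s≤s z≤n)
      e₀₂ = edge< 0F 2F (s≤s z≤n)
      i₀ : Fin k
      i₀ = c (inj₁ 0F)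
      same-code : SameCode (inj₂ (e₀₁ , proj₁ (full e₀₁ i₀))) (inj₂ (e₀₂ , proj₁ (full e₀₂ i₀)))
      same-code t ¬same with t Fin.≟ i₀
      ... | yes refl = ¬same (0 , distTo-0 (proj₂ (full e₀₁ t)) , distTo-0 (proj₂ (full e₀₂ t)))
      ... | no t≢i₀ = ¬same (1 , distTo-1-in e₀₁ , distTo-1-in e₀₂)
        where
        distTo-1-in : ∀ e → DistTo (inj₂ (e , proj₁ (full e i₀))) t 1
        distTo-1-in e = inCopy-distTo-1 (λ ct → t≢i₀ (trans (sym ct) (proj₂ (full e i₀)))) (full e t)

    n<k : n < k
    n<k = ℕ.≰⇒> λ k≤n → ¬all-copies-full λ e → injective⇒surjective (copy-injective e) k≤n

  module OneSpareColour (c : V → Fin (suc n)) (onto : Surjective _≡_ _≡_ c)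
                        (locating : IsLocating G c) where
    open LocatingColouring c onto locating

    private variable
      e e′ : E
      h : Fin n
      t : Fin (suc n)
      a : ℕ

    missing : E → Fin (suc n)
    missing e = proj₁ (misses-some (copy-injective e))

    missing-∉-copy : ∀ e h → c (inj₂ (e , h)) ≢ missing e
    missing-∉-copy e = proj₂ (misses-some (copy-injective e))

    inCopy : ∀ e → t ≢ missing e → InCopy e t
    inCopy e = hits-all-but (copy-injective e) (missing-∉-copy e)

    missing-unique : ∀ e → (∀ h → c (inj₂ (e , h)) ≢ t) → missing e ≡ t
    missing-unique {t} e t∉copy = decidable-stable (missing e Fin.≟ t) λ missing≢t →
      let h , ch = inCopy e (missing≢t ∘ sym) in t∉copy h ch

    copy-distance-differs : ∀ {j h h′} → e ≢ e′ → missing e ≡ j → missing e′ ≡ j →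
      c (inj₂ (e , h)) ≡ c (inj₂ (e′ , h′)) → DistTo (inj₂ (e , h)) j a → ¬ DistTo (inj₂ (e′ , h′)) j a
    copy-distance-differs {e} {e′} {a} {j} {h} {h′} e≢e′ missing≡j missing′≡j same-colour dist dist′ =
      locating⇒¬sameCode locating (λ { refl → e≢e′ refl }) same-code
      where
      same-code : SameCode (inj₂ (e , h)) (inj₂ (e′ , h′))
      same-code t ¬same with c (inj₂ (e , h)) Fin.≟ t | t Fin.≟ j
      ... | yes refl | _ = ¬same (0 , distTo-0 refl , distTo-0 (sym same-colour))
      ... | no _ | yes refl = ¬same (a , dist , dist′)
      ... | no ch≢t | no t≢j =
        ¬same (1 , inCopy-distTo-1 ch≢t (inCopy e (λ t≡ → t≢j (trans t≡ missing≡j)))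
                 , inCopy-distTo-1 (ch≢t ∘ trans same-colour) (inCopy e′ (λ t≡ → t≢j (trans t≡ missing′≡j))))

    module AtDistance3 {e h} (dist₃ : DistTo (inj₂ (e , h)) (missing e) 3) where

      within-2 : ∀ {w ℓ} → Walk G (inj₂ (e , h)) w ℓ → ℓ ≤ 2 → c w ≢ missing e
      within-2 walk ℓ≤2 cw = ℕ.<⇒≱ (s≤s ℓ≤2) (distTo-≤-walk dist₃ cw walk)

      K-avoids : ∀ w → c (inj₁ w) ≢ missing e
      K-avoids w with end₁ e Fin.≟ w
      ... | yes refl = within-2 (step (inj₁ refl) here) (s≤s z≤n)
      ... | no x≢w = within-2 (step (inj₁ refl) (step (K-adjacent x≢w) here)) ≤-refl

      neighbouring-copy : ∀ {g p} → p ∈ₑ e → p ∈ₑ g →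
                          missing g ≡ missing e × Avoids g (missing e) × InCopy g (c (inj₂ (e , h)))
      neighbouring-copy {g} {p} p∈e p∈g =
        missing-g , ((λ w _ → K-avoids w) , λ h′ → subst (_ ≢_) missing-g (missing-∉-copy g h′)) ,
        inCopy g λ ch≡ → missing-∉-copy e h (trans ch≡ missing-g)
        where
        missing-g : missing g ≡ missing e
        missing-g = missing-unique g λ h′ → within-2 (step {w = inj₁ p} p∈e (step p∈g here)) ≤-refl

    open AtDistance3 using (neighbouring-copy)

    missing-distTo≢3 : ¬ DistTo (inj₂ (e , h)) (missing e) 3
    missing-distTo≢3 {e} {h} dist₃ with flanking-edges e
    ... | g₁ , g₂ , x∈g₁ , y∈g₂ , g₁≢e , g₂≢e , g₁≢g₂ =
      flanks (neighbouring-copy dist₃ (inj₁ refl) x∈g₁) (neighbouring-copy dist₃ (inj₂ refl) y∈g₂)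
      where
      Flank : E → Set
      Flank g = missing g ≡ missing e × Avoids g (missing e) × InCopy g (c (inj₂ (e , h)))

      flanks : Flank g₁ → Flank g₂ → ⊥
      flanks (missing₁ , avoids₁ , h₁ , ch₁) (missing₂ , avoids₂ , h₂ , ch₂) =
        ¬¬-distTo-exists (inj₂ (g₁ , h₁)) (missing e) λ (_ , dist₁) →
        ¬¬-distTo-exists (inj₂ (g₂ , h₂)) (missing e) λ (_ , dist₂) →
        conclude (avoids-distTo-2-or-3 avoids₁ dist₁) (avoids-distTo-2-or-3 avoids₂ dist₂) dist₁ dist₂
        where
        conclude : ∀ {b₁ b₂} → b₁ ≡ 2 ⊎ b₁ ≡ 3 → b₂ ≡ 2 ⊎ b₂ ≡ 3 →
                   DistTo (inj₂ (g₁ , h₁)) (missing e) b₁ → DistTo (inj₂ (g₂ , h₂)) (missing e) b₂ → ⊥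
        conclude (inj₂ refl) _ dist₁ _ = copy-distance-differs g₁≢e missing₁ refl ch₁ dist₁ dist₃
        conclude _ (inj₂ refl) _ dist₂ = copy-distance-differs g₂≢e missing₂ refl ch₂ dist₂ dist₃
        conclude (inj₁ refl) (inj₁ refl) dist₁ dist₂ =
          copy-distance-differs g₁≢g₂ missing₁ missing₂ (trans ch₁ (sym ch₂)) dist₁ dist₂

    avoided-missing-injective : e ≢ e′ → Avoids e (missing e) → Avoids e′ (missing e′) →
                                missing e ≢ missing e′
    avoided-missing-injective {e} {e′} e≢e′ avoids avoids′ same-missing =
      ¬¬-distTo-exists (inj₂ (e , h₀)) j λ (_ , dist) →
      ¬¬-distTo-exists (inj₂ (e′ , h₀′)) j λ (_ , dist′) →
      conclude (avoids-distTo-2-or-3 avoids dist)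
               (avoids-distTo-2-or-3 (subst (Avoids e′) (sym same-missing) avoids′) dist′) dist dist′
      where
      j : Fin (suc n)
      j = missing e
      -- The endpoints of e avoid j, so their colour occurs in both copies.
      i : Fin (suc n)
      i = c (inj₁ (end₁ e))
      i≢j : i ≢ j
      i≢j = proj₁ avoids (end₁ e) (inj₁ refl)
      h₀ : Fin n
      h₀ = proj₁ (inCopy e i≢j)
      i≢j′ : i ≢ missing e′
      i≢j′ i≡ = i≢j (trans i≡ (sym same-missing))
      h₀′ : Fin n
      h₀′ = proj₁ (inCopy e′ i≢j′)
      same-colour : c (inj₂ (e , h₀)) ≡ c (inj₂ (e′ , h₀′))
      same-colour = trans (proj₂ (inCopy e i≢j)) (sym (proj₂ (inCopy e′ i≢j′)))

      conclude : ∀ {b b′} → b ≡ 2 ⊎ b ≡ 3 → b′ ≡ 2 ⊎ b′ ≡ 3 →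
                 DistTo (inj₂ (e , h₀)) j b → DistTo (inj₂ (e′ , h₀′)) j b′ → ⊥
      conclude (inj₂ refl) _ dist _ = missing-distTo≢3 dist
      conclude _ (inj₂ refl) _ dist′ =
        missing-distTo≢3 (subst (λ j → DistTo (inj₂ (e′ , h₀′)) j 3) same-missing dist′)
      conclude (inj₁ refl) (inj₁ refl) dist dist′ =
        copy-distance-differs e≢e′ refl (sym same-missing) same-colour dist dist′

    K-sees-every-colour : ∀ x → c (inj₁ x) ≢ t → ¬ ¬ (∃[ w ] (inj₁ x ~ w × c w ≡ t))
    K-sees-every-colour {t} x cx≢t ¬sees with two-edges-at x
    ... | g , g′ , x∈g , x∈g′ , g≢g′ =
      avoided-missing-injective g≢g′ (avoids x∈g) (avoids x∈g′)
                                (trans (missing-t x∈g) (sym (missing-t x∈g′)))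
      where
      -- The copy of an edge at x consists of neighbours of x.
      missing-t : ∀ {g} → x ∈ₑ g → missing g ≡ t
      missing-t x∈g = missing-unique _ λ h ch → ¬sees (_ , x∈g , ch)

      avoids : ∀ {g} → x ∈ₑ g → Avoids g (missing g)
      avoids {g} x∈g = (λ w _ cw → K-avoids w (trans cw (missing-t x∈g))) , missing-∉-copy g
        where
        K-avoids : ∀ w → c (inj₁ w) ≢ t
        K-avoids w with w Fin.≟ x
        ... | yes refl = cx≢t
        ... | no w≢x = λ cw → ¬sees (inj₁ w , K-adjacent (w≢x ∘ sym) , cw)

    K-distTo-1 : ∀ x → c (inj₁ x) ≢ t → ¬ ¬ DistTo (inj₁ x) t 1
    K-distTo-1 x cx≢t ¬dist = K-sees-every-colour x cx≢t λ (_ , x~w , cw) → ¬dist (distTo-1 cx≢t x~w cw)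

    K-colour-injective : Injective _≡_ _≡_ (c ∘ inj₁)
    K-colour-injective {x} {y} cx≡cy = decidable-stable (x Fin.≟ y) λ x≢y →
      locating⇒¬sameCode locating (x≢y ∘ inj₁-injective) same-code
      where
      same-code : SameCode (inj₁ x) (inj₁ y)
      same-code t ¬same with c (inj₁ x) Fin.≟ t
      ... | yes cx≡t = ¬same (0 , distTo-0 cx≡t , distTo-0 (trans (sym cx≡cy) cx≡t))
      ... | no cx≢t =
        K-distTo-1 x cx≢t λ dx → K-distTo-1 y (cx≢t ∘ trans cx≡cy) λ dy → ¬same (1 , dx , dy)

    K-colour-≢ : ∀ j → ∃[ x ] c (inj₁ x) ≢ j
    K-colour-≢ j with c (inj₁ 0F) Fin.≟ j
    ... | no c0≢j = 0F , c0≢j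
    ... | yes c0≡j = 1F , λ c1≡j → 0≢1 (K-colour-injective (trans c0≡j (sym c1≡j)))
      where
      0≢1 : 0F ≢ 1F
      0≢1 ()

    missing-avoided : ∀ e → Avoids e (missing e)
    missing-avoided e = ends-avoid , missing-∉-copy e
      where
      ends-avoid : ∀ w → w ∈ₑ e → c (inj₁ w) ≢ missing e
      ends-avoid w w∈e cw with K-colour-≢ (missing e)
      ... | x , cx≢missing with inCopy e cx≢missing
      ... | h₀ , ch₀ = locating⇒¬sameCode locating (λ ()) same-code
        where
        copy-distTo-1 : ∀ {t} → c (inj₁ x) ≢ t → DistTo (inj₂ (e , h₀)) t 1
        copy-distTo-1 {t} cx≢t with t Fin.≟ missing e
        ... | yes refl = distTo-1 (cx≢t ∘ trans (sym ch₀)) w∈e cw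
        ... | no t≢missing = inCopy-distTo-1 (cx≢t ∘ trans (sym ch₀)) (inCopy e t≢missing)

        same-code : SameCode (inj₂ (e , h₀)) (inj₁ x)
        same-code t ¬same with c (inj₁ x) Fin.≟ t
        ... | yes refl = ¬same (0 , distTo-0 ch₀ , distTo-0 refl)
        ... | no cx≢t = K-distTo-1 x cx≢t λ dx → ¬same (1 , copy-distTo-1 cx≢t , dx)

    missing-injective : Injective _≡_ _≡_ missing
    missing-injective {e} {e′} same-missing = decidable-stable (e ≟ₑ e′) λ e≢e′ →
      avoided-missing-injective e≢e′ (missing-avoided e) (missing-avoided e′) same-missing

    tri≤1+n : tri m ≤ suc n
    tri≤1+n = Fin.injective⇒≤ (edgeAt-injective ∘ missing-injective)

  -- Upper bounds

  module BlockColouring {k : ℕ} (κ : Fin m → Fin k) (φ : E → Fin n → Fin k) where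

    colour : V → Fin k
    colour (inj₁ a) = κ a
    colour (inj₂ (e , h)) = φ e h

    open CoronaColouring colour public

    RainbowPath : V → V → Set
    RainbowPath u v = ∃[ ws ] (IsPath G u ws v × Unique (map colour ws))

    private variable
      u v w₁ w₂ : V

    path₀ : u ~ v → u ≢ v → RainbowPath u v
    path₀ u~v u≢v = [] , (u~v ∷ [-] , (u≢v ∷ []) ∷ [] ∷ []) , []

    path₁ : u ~ w₁ → w₁ ~ v → u ≢ w₁ → u ≢ v → w₁ ≢ v → RainbowPath u v
    path₁ {w₁ = w₁} u~w w~v u≢w u≢v w≢v =
      [ w₁ ] , (u~w ∷ w~v ∷ [-] , (u≢w ∷ u≢v ∷ []) ∷ (w≢v ∷ []) ∷ [] ∷ []) , [] ∷ []

    path₂ : u ~ w₁ → w₁ ~ w₂ → w₂ ~ v → u ≢ w₁ → u ≢ w₂ → u ≢ v → w₁ ≢ w₂ → w₁ ≢ v → w₂ ≢ v →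
            colour w₁ ≢ colour w₂ → RainbowPath u v
    path₂ {w₁ = w₁} {w₂} u~w₁ w₁~w₂ w₂~v u≢w₁ u≢w₂ u≢v w₁≢w₂ w₁≢v w₂≢v cw₁≢cw₂ =
      w₁ ∷ w₂ ∷ [] ,
      (u~w₁ ∷ w₁~w₂ ∷ w₂~v ∷ [-] , (u≢w₁ ∷ u≢w₂ ∷ u≢v ∷ []) ∷ (w₁≢w₂ ∷ w₁≢v ∷ []) ∷ (w₂≢v ∷ []) ∷ [] ∷ []) ,
      (cw₁≢cw₂ ∷ []) ∷ [] ∷ []

    module _ (κ-injective : Injective _≡_ _≡_ κ) where

      rainbow-path : ∀ u v → u ≢ v → RainbowPath u v
      rainbow-path (inj₁ a) (inj₁ b) u≢v = path₀ (K-adjacent (u≢v ∘ cong inj₁)) u≢v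
      rainbow-path (inj₁ a) (inj₂ (e , h)) u≢v with a ∈ₑ? e
      ... | yes a∈e = path₀ a∈e u≢v
      ... | no a∉e =
        path₁ {w₁ = inj₁ (end₁ e)} (K-adjacent (a∉e ∘ inj₁)) (inj₁ refl)
              (a∉e ∘ inj₁ ∘ inj₁-injective) u≢v (λ ())
      rainbow-path (inj₂ (e , h)) (inj₁ a) u≢v with a ∈ₑ? e
      ... | yes a∈e = path₀ a∈e u≢v
      ... | no a∉e =
        path₁ {w₁ = inj₁ (end₁ e)} (inj₁ refl) (K-adjacent (a∉e ∘ inj₁ ∘ sym))
              (λ ()) u≢v (a∉e ∘ inj₁ ∘ sym ∘ inj₁-injective)
      rainbow-path (inj₂ (e , h)) (inj₂ (e′ , h′)) u≢v with e ≟ₑ e′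
      ... | yes refl = path₀ (refl , K-adjacent (u≢v ∘ cong (λ h → inj₂ (e , h)))) u≢v
      ... | no e≢e′ with end₁ e ∈ₑ? e′ | end₂ e ∈ₑ? e′
      ...   | yes x∈e′ | _ = path₁ {w₁ = inj₁ (end₁ e)} (inj₁ refl) x∈e′ (λ ()) u≢v (λ ())
      ...   | no _ | yes y∈e′ = path₁ {w₁ = inj₁ (end₂ e)} (inj₂ refl) y∈e′ (λ ()) u≢v (λ ())
      ...   | no x∉e′ | no _ =
        path₂ {w₁ = inj₁ (end₁ e)} {w₂ = inj₁ (end₁ e′)} (inj₁ refl) (K-adjacent x≢x′) (inj₁ refl)
              (λ ()) (λ ()) u≢v (x≢x′ ∘ inj₁-injective) (λ ()) (λ ()) (x≢x′ ∘ κ-injective)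
        where
        x≢x′ : end₁ e ≢ end₁ e′
        x≢x′ = x∉e′ ∘ inj₁

      module _ (φ-injective : ∀ e → Injective _≡_ _≡_ (φ e))
               (copies-separated : ∀ e e′ → e ≢ e′ → ∃[ t ] (InCopy e t × Avoids e′ t))
               (K-separated : ∀ x e → ∃[ t ] (Near (inj₁ x) t × Avoids e t)) where

        locating : IsLocating G colour
        locating (inj₁ a) (inj₁ b) u≢v =
          κ a , colour-distinguishes refl (u≢v ∘ cong inj₁ ∘ κ-injective ∘ sym)
        locating (inj₁ a) (inj₂ (e , h)) _ with K-separated a e
        ... | t , near , avoids = t , near-far-distinguishes near (avoids⇒far h avoids)
        locating (inj₂ (e , h)) (inj₁ a) _ with K-separated a e
        ... | t , near , avoids = t , distinguishes-sym (near-far-distinguishes near (avoids⇒far h avoids))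
        locating (inj₂ (e , h)) (inj₂ (e′ , h′)) u≢v with e ≟ₑ e′
        ... | yes refl =
          φ e h , colour-distinguishes refl (u≢v ∘ cong (λ h → inj₂ (e , h)) ∘ φ-injective e ∘ sym)
        ... | no e≢e′ with copies-separated e e′ e≢e′
        ...   | t , inCopy , avoids = t , near-far-distinguishes (inCopy⇒near h inCopy) (avoids⇒far h′ avoids)

        locating-rainbow : (∀ t → ∃[ v ] colour v ≡ t) → IsLocatingRainbowColoring G k colour
        locating-rainbow onto =
          ((λ t → proj₁ (onto t) , λ { refl → proj₂ (onto t) }) , rainbow-path) , locating

  opposite : Fin m → E
  opposite 0F = edge< 1F 2F (s≤s (s≤s z≤n))
  opposite 1F = edge< 0F (Fin.fromℕ (2 + m′)) (s≤s z≤n)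
  opposite (Fin.suc (Fin.suc y)) = edge< 0F (Fin.suc (Fin.inject₁ y)) (s≤s z≤n)

  ∉-opposite : ∀ x → ¬ x ∈ₑ opposite x
  ∉-opposite 0F = Sum.[ (λ ()) , (λ ()) ]
  ∉-opposite 1F = Sum.[ (λ ()) , (λ ()) ]
  ∉-opposite (Fin.suc (Fin.suc y)) = Sum.[ (λ ()) , suc≢inject₁ ∘ Fin.suc-injective ]
    where
    suc≢inject₁ : ∀ {p} {y : Fin p} → Fin.suc y ≢ Fin.inject₁ y
    suc≢inject₁ {y = y} eq = ℕ.1+n≢n (trans (cong toℕ eq) (Fin.toℕ-inject₁ y))

  opposite-injective : Injective _≡_ _≡_ opposite
  opposite-injective {0F} {0F} _ = refl
  opposite-injective {1F} {1F} _ = refl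
  opposite-injective {Fin.suc (Fin.suc y)} {Fin.suc (Fin.suc y′)} eq =
    cong (Fin.suc ∘ Fin.suc) (Fin.inject₁-injective (Fin.suc-injective (cong end₂ eq)))
  opposite-injective {1F} {Fin.suc (Fin.suc _)} eq =
    ⊥-elim (Fin.fromℕ≢inject₁ (Fin.suc-injective (cong end₂ eq)))
  opposite-injective {Fin.suc (Fin.suc _)} {1F} eq =
    ⊥-elim (Fin.fromℕ≢inject₁ (Fin.suc-injective (cong end₂ (sym eq))))
  opposite-injective {0F} {1F} ()
  opposite-injective {0F} {Fin.suc (Fin.suc _)} ()
  opposite-injective {1F} {0F} ()
  opposite-injective {Fin.suc (Fin.suc _)} {0F} ()

  module SpareColourPerEdge (tri≤1+n : tri m ≤ suc n) where

    spare : E → Fin (suc n)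
    spare e = fromℕ< (ℕ.<-≤-trans (index<tri e) tri≤1+n)

    spare-injective : Injective _≡_ _≡_ spare
    spare-injective = index-injective ∘ Fin.fromℕ<-injective _ _ _ _

    open BlockColouring (spare ∘ opposite) (punchIn ∘ spare)

    spare-avoided : ∀ e → Avoids e (spare e)
    spare-avoided e =
      (λ w w∈e κw≡ → ∉-opposite w (subst (w ∈ₑ_) (sym (spare-injective {opposite w} {e} κw≡)) w∈e)) ,
      Fin.punchInᵢ≢i (spare e)

    K-near : ∀ x t → Near (inj₁ x) t
    K-near x t with two-edges-at x
    ... | g , g′ , x∈g , x∈g′ , g≢g′ with t Fin.≟ spare g
    ...   | no t≢spare = inCopy⇒K-near g x∈g (punchIn-onto t≢spare)
    ...   | yes refl = inCopy⇒K-near g′ x∈g′ (punchIn-onto (g≢g′ ∘ spare-injective))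

    locating-rainbow-colouring : IsLocatingRainbowColoring G (suc n) colour
    locating-rainbow-colouring =
      locating-rainbow (opposite-injective ∘ spare-injective) (λ e → Fin.punchIn-injective (spare e) _ _)
        (λ e e′ e≢e′ → spare e′ , punchIn-onto (e≢e′ ∘ sym ∘ spare-injective) , spare-avoided e′)
        (λ x e → spare e , K-near x (spare e) , spare-avoided e)
        (λ t → near⇒coloured (inj₁ 0F) (K-near 0F t))

  module TwoSpareColoursPerEdge (m≤n : m ≤ n) (3<m : 3 < m) where

    lo hi : E → ℕ
    lo e = toℕ (end₁ e)
    hi e = toℕ (end₂ e)

    hi<n : ∀ e → hi e < n
    hi<n e = ℕ.<-≤-trans (Fin.toℕ<n (end₂ e)) m≤n

    lo<n : ∀ e → lo e < n
    lo<n e = ℕ.<-trans (end₁<end₂ e) (hi<n e)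

    -- The copy of e misses hi + 1 and lo + 1, except that the top colour n + 1
    -- replaces lo + 1 when lo + 1 = hi is the colour of an endpoint.
    spare₁ spare₂ : E → ℕ
    spare₁ e = suc (hi e)
    spare₂ e with hi e ℕ.≟ suc (lo e)
    ... | yes _ = suc n
    ... | no _ = suc (lo e)

    spare₂-cases : ∀ e → (hi e ≡ suc (lo e) × spare₂ e ≡ suc n) ⊎
                         (hi e ≢ suc (lo e) × spare₂ e ≡ suc (lo e))
    spare₂-cases e with hi e ℕ.≟ suc (lo e)
    ... | yes consecutive = inj₁ (consecutive , refl)
    ... | no ¬consecutive = inj₂ (¬consecutive , refl)

    spare₂≡suc⇒lo : ∀ e {s} → spare₂ e ≡ suc s → s < n → lo e ≡ s
    spare₂≡suc⇒lo e eq s<n with spare₂-cases e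
    ... | inj₁ (_ , top) = ⊥-elim (ℕ.<-irrefl (ℕ.suc-injective (trans (sym eq) top)) s<n)
    ... | inj₂ (_ , low) = ℕ.suc-injective (trans (sym low) eq)

    Spare : E → ℕ → Set
    Spare e s = s ≡ spare₁ e ⊎ s ≡ spare₂ e

    Spare? : ∀ e s → Dec (Spare e s)
    Spare? e s = (s ℕ.≟ spare₁ e) ⊎-dec (s ℕ.≟ spare₂ e)

    spare₁≢spare₂ : ∀ e → spare₁ e ≢ spare₂ e
    spare₁≢spare₂ e eq with spare₂-cases e
    ... | inj₁ (_ , top) = ℕ.<-irrefl (ℕ.suc-injective (trans eq top)) (hi<n e)
    ... | inj₂ (_ , low) = ℕ.<-irrefl (sym (ℕ.suc-injective (trans eq low))) (end₁<end₂ e)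

    spare≢ends : ∀ e {s} → Spare e s → s ≢ lo e × s ≢ hi e
    spare≢ends e (inj₁ refl) = ℕ.>⇒≢ (ℕ.<-trans (end₁<end₂ e) (ℕ.n<1+n _)) , ℕ.1+n≢n
    spare≢ends e (inj₂ refl) with spare₂-cases e
    ... | inj₁ (_ , top) rewrite top = ℕ.>⇒≢ (ℕ.m<n⇒m<1+n (lo<n e)) , ℕ.>⇒≢ (ℕ.m<n⇒m<1+n (hi<n e))
    ... | inj₂ (¬consecutive , low) rewrite low = ℕ.1+n≢n , ¬consecutive ∘ sym

    spares-injective : ∀ {e e′} → (spare₁ e ≡ spare₁ e′ × spare₂ e ≡ spare₂ e′) ⊎
                                  (spare₁ e ≡ spare₂ e′ × spare₂ e ≡ spare₁ e′) → e ≡ e′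
    spares-injective {e} {e′} (inj₁ (same₁ , same₂)) =
      edge-≡ (cong₂ _,_ (Fin.toℕ-injective lo≡) (Fin.toℕ-injective hi≡))
      where
      hi≡ : hi e ≡ hi e′
      hi≡ = ℕ.suc-injective same₁
      lo≡ : lo e ≡ lo e′
      lo≡ with spare₂-cases e
      ... | inj₂ (_ , low) = sym (spare₂≡suc⇒lo e′ (trans (sym same₂) low) (lo<n e))
      ... | inj₁ (consecutive , top) with spare₂-cases e′
      ...   | inj₁ (consecutive′ , _) = ℕ.suc-injective (trans (sym consecutive) (trans hi≡ consecutive′))
      ...   | inj₂ (_ , low′) =
        ⊥-elim (ℕ.<-irrefl (ℕ.suc-injective (trans (sym low′) (trans (sym same₂) top))) (lo<n e′))
    spares-injective {e} {e′} (inj₂ (cross₁ , cross₂)) =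
      ⊥-elim (ℕ.<-asym (end₁<end₂ e) (subst₂ _<_ lo′≡hi (sym lo≡hi′) (end₁<end₂ e′)))
      where
      lo′≡hi : lo e′ ≡ hi e
      lo′≡hi = spare₂≡suc⇒lo e′ (sym cross₁) (hi<n e)
      lo≡hi′ : lo e ≡ hi e′
      lo≡hi′ = spare₂≡suc⇒lo e cross₂ (hi<n e′)

    spare₁<2+n : ∀ e → spare₁ e < 2 + n
    spare₁<2+n e = s≤s (ℕ.m≤n⇒m≤1+n (hi<n e))

    spare₂<2+n : ∀ e → spare₂ e < 2 + n
    spare₂<2+n e with spare₂-cases e
    ... | inj₁ (_ , top) rewrite top = ≤-refl
    ... | inj₂ (_ , low) rewrite low = s≤s (ℕ.m≤n⇒m≤1+n (lo<n e))

    colour₁ colour₂ : E → Fin (2 + n)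
    colour₁ e = fromℕ< (spare₁<2+n e)
    colour₂ e = fromℕ< (spare₂<2+n e)

    colour₁≢colour₂ : ∀ e → colour₁ e ≢ colour₂ e
    colour₁≢colour₂ e = spare₁≢spare₂ e ∘ Fin.fromℕ<-injective _ _ (spare₁<2+n e) (spare₂<2+n e)

    toℕ-colour₁ : ∀ e → toℕ (colour₁ e) ≡ spare₁ e
    toℕ-colour₁ e = Fin.toℕ-fromℕ< (spare₁<2+n e)

    toℕ-colour₂ : ∀ e → toℕ (colour₂ e) ≡ spare₂ e
    toℕ-colour₂ e = Fin.toℕ-fromℕ< (spare₂<2+n e)

    κ : Fin m → Fin (2 + n)
    κ x = Fin.inject≤ x (ℕ.m≤n⇒m≤o+n 2 m≤n)

    toℕ-κ : ∀ x → toℕ (κ x) ≡ toℕ x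
    toℕ-κ x = Fin.toℕ-inject≤ x (ℕ.m≤n⇒m≤o+n 2 m≤n)

    open BlockColouring κ (λ e → skip₂ (colour₁ e) (colour₂ e) (colour₁≢colour₂ e))

    spare⇒avoided : ∀ e t → Spare e (toℕ t) → Avoids e t
    spare⇒avoided e t spare = ends , copy
      where
      ends : ∀ w → w ∈ₑ e → κ w ≢ t
      ends w w∈e κw≡t with trans (sym (toℕ-κ w)) (cong toℕ κw≡t)
      ends w (inj₁ refl) _ | w≡t = proj₁ (spare≢ends e spare) (sym w≡t)
      ends w (inj₂ refl) _ | w≡t = proj₂ (spare≢ends e spare) (sym w≡t)
      copy : ∀ h → colour (inj₂ (e , h)) ≢ t
      copy h φ≡t = Sum.[ skip₂-≢ₗ (colour₁≢colour₂ e) h ∘ trans φ≡t ∘ ≡colour₁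
                       , skip₂-≢ᵣ (colour₁≢colour₂ e) h ∘ trans φ≡t ∘ ≡colour₂ ] spare
        where
        ≡colour₁ : toℕ t ≡ spare₁ e → t ≡ colour₁ e
        ≡colour₁ t≡ = Fin.toℕ-injective (trans t≡ (sym (toℕ-colour₁ e)))
        ≡colour₂ : toℕ t ≡ spare₂ e → t ≡ colour₂ e
        ≡colour₂ t≡ = Fin.toℕ-injective (trans t≡ (sym (toℕ-colour₂ e)))

    ¬spare⇒inCopy : ∀ e t → ¬ Spare e (toℕ t) → InCopy e t
    ¬spare⇒inCopy e t ¬spare = skip₂-onto (colour₁≢colour₂ e)
      (λ t≡ → ¬spare (inj₁ (trans (cong toℕ t≡) (toℕ-colour₁ e))))
      (λ t≡ → ¬spare (inj₂ (trans (cong toℕ t≡) (toℕ-colour₂ e))))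

    -- The top colour must be seen from every vertex, through an edge whose copy contains it;
    -- vertex 1 needs the edge {1, 3}, which is why m > 3.
    non-consecutive-edge-at : ∀ x → ∃[ g ] (x ∈ₑ g × hi g ≢ suc (lo g))
    non-consecutive-edge-at 0F = edge< 0F 2F (s≤s z≤n) , inj₁ refl , λ ()
    non-consecutive-edge-at 1F =
      edge< 1F (fromℕ< 3<m) (subst (1 <_) (sym (Fin.toℕ-fromℕ< 3<m)) (s≤s (s≤s z≤n))) , inj₁ refl ,
      λ 3≡2 → 3≢2 (trans (sym (Fin.toℕ-fromℕ< 3<m)) 3≡2)
      where
      3≢2 : 3 ≢ 2
      3≢2 ()
    non-consecutive-edge-at (Fin.suc (Fin.suc z)) =
      edge< 0F (Fin.suc (Fin.suc z)) (s≤s z≤n) , inj₂ refl , λ ()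

    top-near : ∀ x t → toℕ t ≡ suc n → Near (inj₁ x) t
    top-near x t top with non-consecutive-edge-at x
    ... | g , x∈g , ¬consecutive = inCopy⇒K-near g x∈g (¬spare⇒inCopy g t ¬spare)
      where
      ¬spare : ¬ Spare g (toℕ t)
      ¬spare (inj₁ eq) = ℕ.<-irrefl (ℕ.suc-injective (trans (sym eq) top)) (hi<n g)
      ¬spare (inj₂ eq) with spare₂-cases g
      ... | inj₁ (consecutive , _) = ¬consecutive consecutive
      ... | inj₂ (_ , low) = ℕ.<-irrefl (ℕ.suc-injective (trans (sym low) (trans (sym eq) top))) (lo<n g)

    K-near-spare₂ : ∀ x e → Near (inj₁ x) (colour₂ e)
    K-near-spare₂ x e with spare₂-cases e
    ... | inj₁ (_ , top) = top-near x (colour₂ e) (trans (toℕ-colour₂ e) top)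
    ... | inj₂ (_ , low) = subst (Near (inj₁ x)) κy≡ (K-near-K-colour x y)
      where
      1+lo<m : suc (lo e) < m
      1+lo<m = ℕ.≤-<-trans (end₁<end₂ e) (Fin.toℕ<n (end₂ e))
      y : Fin m
      y = fromℕ< 1+lo<m
      κy≡ : κ y ≡ colour₂ e
      κy≡ = Fin.toℕ-injective (trans (toℕ-κ y)
              (trans (Fin.toℕ-fromℕ< 1+lo<m) (sym (trans (toℕ-colour₂ e) low))))

    copies-separated : ∀ e e′ → e ≢ e′ → ∃[ t ] (InCopy e t × Avoids e′ t)
    copies-separated e e′ e≢e′ with Spare? e (spare₁ e′) | Spare? e (spare₂ e′)
    ... | no ¬spare | _ = colour₁ e′ , ¬spare⇒inCopy e _ (¬spare ∘ subst (Spare e) (toℕ-colour₁ e′))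
                                      , spare⇒avoided e′ _ (inj₁ (toℕ-colour₁ e′))
    ... | yes _ | no ¬spare = colour₂ e′ , ¬spare⇒inCopy e _ (¬spare ∘ subst (Spare e) (toℕ-colour₂ e′))
                                         , spare⇒avoided e′ _ (inj₂ (toℕ-colour₂ e′))
    ... | yes spare₁ | yes spare₂ =
      ⊥-elim (e≢e′ (sym (spares-injective (pair-⊆ (spare₁≢spare₂ e′) spare₁ spare₂))))

    onto : ∀ t → ∃[ v ] colour v ≡ t
    onto t with toℕ t ℕ.<? m
    ... | yes t<m = inj₁ (fromℕ< t<m) , Fin.toℕ-injective (trans (toℕ-κ _) (Fin.toℕ-fromℕ< t<m))
    ... | no t≮m = inj₂ (g , proj₁ in-g) , proj₂ in-g
      where
      g : E
      g = edge< 0F 2F (s≤s z≤n)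
      3<t : 3 < toℕ t
      3<t = ℕ.<-≤-trans 3<m (ℕ.≮⇒≥ t≮m)
      in-g : InCopy g t
      in-g = ¬spare⇒inCopy g t λ where
        (inj₁ t≡3) → ℕ.<⇒≢ 3<t (sym t≡3)
        (inj₂ t≡1) → ℕ.<⇒≢ (ℕ.<-trans (s≤s (s≤s z≤n)) 3<t) (sym t≡1)

    locating-rainbow-colouring : IsLocatingRainbowColoring G (2 + n) colour
    locating-rainbow-colouring =
      locating-rainbow (Fin.inject≤-injective _ _ _ _) (λ e → skip₂-injective (colour₁≢colour₂ e))
        copies-separated (λ x e → colour₂ e , K-near-spare₂ x e , spare⇒avoided e _ (inj₂ (toℕ-colour₂ e)))
        onto

  more-than-n-colours : ∀ {k} → HasLocatingRainbowColoring G k → n < k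
  more-than-n-colours (c , (onto , _) , locating) = LocatingColouring.n<k c onto locating

  n+1-colours⇒tri≤1+n : HasLocatingRainbowColoring G (suc n) → tri m ≤ suc n
  n+1-colours⇒tri≤1+n (c , (onto , _) , locating) = OneSpareColour.tri≤1+n c onto locating

m∸1≤n⇒m≤1+n : ∀ {m n} → m ∸ 1 ≤ n → m ≤ suc n
m∸1≤n⇒m≤1+n {zero} _ = z≤n
m∸1≤n⇒m≤1+n {suc m} m≤n = s≤s m≤n

n<m∸1⇒1+n<m : ∀ {m n} → n < m ∸ 1 → suc n < m
n<m∸1⇒1+n<m {suc m} n<m = s≤s n<m

1+n<tri[m]⇒3<m : ∀ {m n} → m ≤ n → suc n < tri m → 3 < m
1+n<tri[m]⇒3<m {0} _ ()
1+n<tri[m]⇒3<m {1} _ ()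
1+n<tri[m]⇒3<m {2} _ (s≤s ())
1+n<tri[m]⇒3<m {3} m≤n 1+n<tri = ⊥-elim (ℕ.<⇒≱ 1+n<tri (ℕ.m≤n⇒m≤1+n m≤n))
1+n<tri[m]⇒3<m {suc (suc (suc (suc _)))} _ _ = s≤s (s≤s (s≤s (s≤s z≤n)))

-- The hypothesis 2 ≤ n is implied by 3 ≤ m ≤ n.
mainTheorem11 : (m n : ℕ) → 3 ≤ m → 2 ≤ n → m ≤ n →
    ((m * (m ∸ 1)) / 2 ∸ 1 ≤ n → rvcl≡ (K m ◇ K n) (n + 1)) ×
    (n < (m * (m ∸ 1)) / 2 ∸ 1 → rvcl≡ (K m ◇ K n) (n + 2))
mainTheorem11 m@(suc (suc (suc m′))) n (s≤s (s≤s (s≤s _))) _ m≤n = few-edges , many-edges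
  where
  open Corona m′ n
    using (G; more-than-n-colours; n+1-colours⇒tri≤1+n; module SpareColourPerEdge; module TwoSpareColoursPerEdge)

  few-edges : (m * (m ∸ 1)) / 2 ∸ 1 ≤ n → rvcl≡ G (n + 1)
  few-edges bound = subst (rvcl≡ G) (ℕ.+-comm 1 n)
    (s≤s z≤n , (_ , SpareColourPerEdge.locating-rainbow-colouring tri≤1+n) , λ _ _ → more-than-n-colours)
    where
    tri≤1+n : tri m ≤ suc n
    tri≤1+n = m∸1≤n⇒m≤1+n (subst (λ e → e ∸ 1 ≤ n) (half-m[m∸1]≡tri m) bound)

  many-edges : n < (m * (m ∸ 1)) / 2 ∸ 1 → rvcl≡ G (n + 2)
  many-edges bound = subst (rvcl≡ G) (ℕ.+-comm 2 n)
    (s≤s z≤n , (_ , TwoSpareColoursPerEdge.locating-rainbow-colouring m≤n 3<m) , least)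
    where
    1+n<tri : suc n < tri m
    1+n<tri = n<m∸1⇒1+n<m (subst (λ e → n < e ∸ 1) (half-m[m∸1]≡tri m) bound)

    3<m : 3 < m
    3<m = 1+n<tri[m]⇒3<m m≤n 1+n<tri

    least : ∀ k → 1 ≤ k → HasLocatingRainbowColoring G k → suc (suc n) ≤ k
    least k _ colouring with k ℕ.≟ suc n
    ... | yes refl = ⊥-elim (ℕ.<⇒≱ 1+n<tri (n+1-colours⇒tri≤1+n colouring))
    ... | no k≢1+n = ℕ.≤∧≢⇒< (more-than-n-colours colouring) (k≢1+n ∘ sym)
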